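{- For every $N$-tableau $T$ on $A$ and every letter $x\in A$, $x\to T$ is an $N$-tableau.
   Context: $A$ is a finite totally ordered alphabet. Tableaux are in French convention (rows numbered from the bottom). An $N$-tableau is a tableau with strictly increasing rows in which each row, viewed as a subset of $A$, is contained in the row below (equivalently, rows $R_1\supseteq R_2\supseteq\cdots$ as sets with $\min R_1<\min R_2<\cdots$). Left insertion $x\to T$: let the rows of $T$ be $R_1,\ldots,R_k$ (bottom to top, as subsets), $p_i=\min R_i$. For each $i$ let $y_i$ be the smallest element of $R_i$ strictly greater than $x$, if it exists. Let $r$ be the largest $i$ with $x\in R_i$, and $r=0$ if none. Case 1: if $T$ is empty or $x\leq p_1$, $x\to T$ is obtained by replacing $R_1$ by $R_1\cup\{x\}$. Otherwise $x>p_1$; let $t'$ be the largest $i$ with $x>p_i$ and $t=t'+1$ (if $t=k+1$, $R_{k+1}$ denotes a new empty row). Case 2: if $R_t$ is nonempty and $x\geq p_t$ (then $x=p_t$), $x\to T=T$. Case 3: otherwise, $x\to T$ is obtained from $T$ by (i) adding $x$ to rows $R_{r+1},\ldots,R_t$, and (ii) for each $i$ with $r+2\leq i\leq t$, removing $y_i$ from $R_i$ if $y_i,y_{i-1}$ both exist and $y_i=y_{i-1}$ (with the $y_i$ computed in $T$). -}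

module Defs where

open import Data.Nat as ℕ using (ℕ; zero; suc; _<ᵇ_; _≤ᵇ_; _⊔_)
open import Data.Fin as Fin using (Fin; toℕ)
open import Data.Fin.Subset using (Subset; _∈_; _⊆_; _∪_; ⁅_⁆; ⊥; Nonempty)
open import Data.Fin.Properties using (_≟_)
open import Data.Vec using (Vec; lookup; _[_]≔_)
open import Data.List using (List; []; _∷_; applyUpTo)
open import Data.Bool using (Bool; true; false; if_then_else_; _∧_; not)
open import Data.Maybe using (Maybe; just; nothing)
open import Data.Product using (_×_)
open import Data.Unit using (⊤)
open import Relation.Nullary using (yes; no)
open import Function using (_∘_)

-- The alphabet A is Fin n with its usual total order.
-- A tableau is a list of rows R₁, R₂, … (bottom to top), each row a
-- strictly increasing word, represented as the subset of its letters.

Tableau : ℕ → Set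
Tableau n = List (Subset n)

IsMin : ∀ {n} → Fin n → Subset n → Set
IsMin m R = m ∈ R × (∀ a → a ∈ R → m Fin.≤ a)

NStep : ∀ {n} → Subset n → Subset n → Set
NStep R S = S ⊆ R × (∀ mR mS → IsMin mR R → IsMin mS S → mR Fin.< mS)

IsNTableau : ∀ {n} → Tableau n → Set
IsNTableau [] = ⊤
IsNTableau (R ∷ []) = Nonempty R
IsNTableau (R ∷ S ∷ rest) = Nonempty R × NStep R S × IsNTableau (S ∷ rest)

least : ∀ {n} → (Fin n → Bool) → Maybe (Fin n)
least {zero} P = nothing
least {suc n} P = if P Fin.zero then just Fin.zero
                  else Data.Maybe.map Fin.suc (least (P ∘ Fin.suc))
  where import Data.Maybe

minRow : ∀ {n} → Subset n → Maybe (Fin n)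
minRow R = least (lookup R)

above : ∀ {n} → Fin n → Subset n → Maybe (Fin n)
above x R = least (λ a → lookup R a ∧ (toℕ x <ᵇ toℕ a))

-- row i (1-indexed); the empty subset if out of range
row : ∀ {n} → Tableau n → ℕ → Subset n
row [] i = ⊥
row (R ∷ T) zero = ⊥
row (R ∷ T) (suc zero) = R
row (R ∷ T) (suc (suc i)) = row T (suc i)

len : ∀ {n} → Tableau n → ℕ
len [] = 0
len (_ ∷ T) = suc (len T)

-- largest i ∈ {1,…,k} with P i, or 0 if none
lastIdx : (ℕ → Bool) → ℕ → ℕ
lastIdx P zero = zero
lastIdx P (suc k) = if P (suc k) then suc k else lastIdx P k

le? : ∀ {n} → Fin n → Maybe (Fin n) → Bool
le? x (just m) = toℕ x ≤ᵇ toℕ m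
le? x nothing = false

ltM : ∀ {n} → Maybe (Fin n) → Fin n → Bool
ltM (just p) x = toℕ p <ᵇ toℕ x
ltM nothing x = false

sameY : ∀ {n} → Maybe (Fin n) → Maybe (Fin n) → Maybe (Fin n)
sameY (just a) (just b) with a ≟ b
... | yes _ = just a
... | no _ = nothing
sameY _ _ = nothing

removeM : ∀ {n} → Subset n → Maybe (Fin n) → Subset n
removeM R (just y) = R [ y ]≔ false
removeM R nothing = R

case1 : ∀ {n} → Fin n → Tableau n → Tableau n
case1 x [] = ⁅ x ⁆ ∷ []
case1 x (R ∷ T) = (R ∪ ⁅ x ⁆) ∷ T

leftInsert : ∀ {n} → Fin n → Tableau n → Tableau n
leftInsert x [] = case1 x []
leftInsert {n} x T@(R₁ ∷ _) =
  if le? x (minRow R₁) then case1 x T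
  else (if (t ≤ᵇ k) ∧ ltOrEq then T else case3)
  where
  k : ℕ
  k = len T
  p : ℕ → Maybe (Fin n)
  p i = minRow (row T i)
  y : ℕ → Maybe (Fin n)
  y i = above x (row T i)
  t′ : ℕ
  t′ = lastIdx (λ i → ltM (p i) x) k
  t : ℕ
  t = suc t′
  ltOrEq : Bool
  ltOrEq with p t
  ... | just m = toℕ m ≤ᵇ toℕ x
  ... | nothing = false
  r : ℕ
  r = lastIdx (λ i → lookup (row T i) x) k
  newRow : ℕ → Subset n
  newRow i =
    if (suc r ≤ᵇ i) ∧ (i ≤ᵇ t)
    then (if suc (suc r) ≤ᵇ i
          then removeM (row T i ∪ ⁅ x ⁆) (sameY (y i) (y (ℕ.pred i)))
          else row T i ∪ ⁅ x ⁆)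
    else row T i
  case3 : Tableau n
  case3 = applyUpTo (newRow ∘ suc) (k ⊔ t)

module Submission where

-- Case 1 only puts x below the minimum of R₁ and Case 2 changes nothing. In
-- Case 3 let R′ᵢ be the new rows: rows i ≤ r and i > t are untouched, rows
-- r < i ≤ t gain x and may lose yᵢ > x. Containment R′ᵢ₊₁ ⊆ R′ᵢ is delicate
-- only for r < i < t: if yᵢ ∈ Rᵢ₊₁ were deleted from row i, then yᵢ₊₁ = yᵢ,
-- so it was deleted from row i + 1 as well; at i = t, y_t = p_t < p_{t+1}.
-- For the minima it is enough to find in R′ᵢ a letter below all of R′ᵢ₊₁:
-- pᵢ < x for i < t (only letters above x are deleted), and x < p_t for i = t.

open import Defs
open import Data.Bool using (Bool; true; false; if_then_else_; _∧_)
open import Data.Bool.Properties using (T-≡; if-float; ∧-zeroʳ)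
open import Data.Fin as F using (Fin; toℕ)
open import Data.Fin.Properties using (toℕ-injective)
open import Data.Fin.Subset using (Subset; _∈_; _∉_; _⊆_; _∪_; ⁅_⁆; Nonempty)
open import Data.Fin.Subset.Properties using (∉⊥; x∈⁅x⁆; x∈⁅y⁆⇒x≡y; x∈p∪q⁻; x∈p∪q⁺)
open import Data.List using ([]; _∷_; applyUpTo)
open import Data.Maybe using (Maybe; just; nothing)
open import Data.Nat using (ℕ; zero; suc; pred; _≤_; _<_; _≤ᵇ_; _<ᵇ_; _⊔_; z≤n; s≤s)
open import Data.Nat.Properties
open import Data.Product using (∃; _×_; _,_; proj₁; proj₂)
open import Data.Sum as Sum using (_⊎_; inj₁; inj₂)
open import Data.Unit using (tt)
open import Data.Vec using (lookup)
open import Data.Vec.Properties using (lookup⇒[]=; []=⇒lookup; lookup∘update; lookup∘update′)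
open import Function using (_∘_)
open import Function.Bundles using (Equivalence)
open import Relation.Binary.PropositionalEquality
open import Relation.Binary.Definitions using (tri<; tri≈; tri>)
open import Relation.Nullary using (¬_; yes; no; contradiction)

private
  variable
    n : ℕ
    a x z m : Fin n
    R S : Subset n

≤ᵇ≡true⇒≤ : ∀ {i j} → (i ≤ᵇ j) ≡ true → i ≤ j
≤ᵇ≡true⇒≤ {i} {j} = ≤ᵇ⇒≤ i j ∘ Equivalence.from T-≡

<ᵇ≡true⇒< : ∀ {i j} → (i <ᵇ j) ≡ true → i < j
<ᵇ≡true⇒< {i} {j} = <ᵇ⇒< i j ∘ Equivalence.from T-≡

≤⇒≤ᵇ≡true : ∀ {i j} → i ≤ j → (i ≤ᵇ j) ≡ true
≤⇒≤ᵇ≡true = Equivalence.to T-≡ ∘ ≤⇒≤ᵇ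

<⇒<ᵇ≡true : ∀ {i j} → i < j → (i <ᵇ j) ≡ true
<⇒<ᵇ≡true = Equivalence.to T-≡ ∘ <⇒<ᵇ

≰⇒≤ᵇ≡false : ∀ {i j} → ¬ i ≤ j → (i ≤ᵇ j) ≡ false
≰⇒≤ᵇ≡false {i} {j} i≰j with i ≤ᵇ j in eq
... | true  = contradiction (≤ᵇ≡true⇒≤ eq) i≰j
... | false = refl

if-true : ∀ {A : Set} {b} {u v : A} → b ≡ true → (if b then u else v) ≡ u
if-true refl = refl

if-false : ∀ {A : Set} {b} {u v : A} → b ≡ false → (if b then u else v) ≡ v
if-false refl = refl

least-just : ∀ (P : Fin n → Bool) → least P ≡ just m →
  P m ≡ true × (∀ a → P a ≡ true → toℕ m ≤ toℕ a)
least-just {suc n} P eq with P F.zero in P0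
least-just {suc n} P refl | true = P0 , λ _ _ → z≤n
least-just {suc n} P eq | false with least (P ∘ F.suc) in eq′
least-just {suc n} P refl | false | just m = proj₁ ih , λ where
    F.zero    P0′ → contradiction (trans (sym P0′) P0) λ ()
    (F.suc a) Pa  → s≤s (proj₂ ih a Pa)
  where ih = least-just (P ∘ F.suc) eq′

least-nothing : ∀ (P : Fin n → Bool) → least P ≡ nothing → ∀ a → P a ≡ false
least-nothing {suc n} P eq a with P F.zero in P0
least-nothing {suc n} P () a | true
least-nothing {suc n} P eq a | false with least (P ∘ F.suc) in eq′
least-nothing {suc n} P () a | false | just _
least-nothing {suc n} P eq F.zero    | false | nothing = P0
least-nothing {suc n} P eq (F.suc a) | false | nothing = least-nothing (P ∘ F.suc) eq′ a

∈⇒lookup : a ∈ R → lookup R a ≡ true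
∈⇒lookup = []=⇒lookup

lookup⇒∈ : lookup R a ≡ true → a ∈ R
lookup⇒∈ {R = R} {a = a} = lookup⇒[]= a R

minRow-just : minRow R ≡ just m → IsMin m R
minRow-just {R = R} eq =
  let m∈R , m≤ = least-just (lookup R) eq
  in lookup⇒∈ m∈R , λ a a∈R → m≤ a (∈⇒lookup a∈R)

minRow-nothing : minRow R ≡ nothing → a ∉ R
minRow-nothing {R = R} {a = a} eq a∈R =
  contradiction (trans (sym (∈⇒lookup a∈R)) (least-nothing (lookup R) eq a)) λ ()

nonempty⇒min : Nonempty R → ∃ λ m → IsMin m R
nonempty⇒min {R = R} (a , a∈R) with minRow R in eq
... | just m  = m , minRow-just eq
... | nothing = contradiction a∈R (minRow-nothing eq)

above-just : above x R ≡ just z →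
  z ∈ R × toℕ x < toℕ z × (∀ a → a ∈ R → toℕ x < toℕ a → toℕ z ≤ toℕ a)
above-just {x = x} {R = R} eq =
  let holds , least≤ = least-just (λ a → lookup R a ∧ (toℕ x <ᵇ toℕ a)) eq
  in lookup⇒∈ (∧-true₁ holds) , <ᵇ≡true⇒< (∧-true₂ holds) ,
     λ a a∈R x<a → least≤ a (cong₂ _∧_ (∈⇒lookup a∈R) (<⇒<ᵇ≡true x<a))
  where
  ∧-true₁ : ∀ {b c} → (b ∧ c) ≡ true → b ≡ true
  ∧-true₁ {true} _ = refl
  ∧-true₂ : ∀ {b c} → (b ∧ c) ≡ true → c ≡ true
  ∧-true₂ {true} e = e

above-nothing : above x R ≡ nothing → a ∈ R → ¬ toℕ x < toℕ a
above-nothing {x = x} {R = R} {a = a} eq a∈R x<a =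
  contradiction (trans (sym (cong₂ _∧_ (∈⇒lookup a∈R) (<⇒<ᵇ≡true x<a)))
                       (least-nothing (λ a → lookup R a ∧ (toℕ x <ᵇ toℕ a)) eq a))
                λ ()

above-mono : S ⊆ R → a ∈ S → above x R ≡ just a → above x S ≡ just a
above-mono {S = S} {R = R} {a = a} {x = x} S⊆R a∈S eq
  with above-just {R = R} eq | above x S in eqS
... | _ , x<a , a≤ | nothing = contradiction x<a (above-nothing eqS a∈S)
... | _ , x<a , a≤ | just w with above-just {R = S} eqS
...   | w∈S , x<w , w≤ = cong just (toℕ-injective (≤-antisym (w≤ a a∈S x<a) (a≤ w (S⊆R w∈S) x<w)))

above-all : (∀ a → a ∈ R → toℕ x < toℕ a) → above x R ≡ just z → IsMin z R
above-all x<R eq =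
  let z∈R , _ , z≤ = above-just eq in z∈R , λ a a∈R → z≤ a a∈R (x<R a a∈R)

∪⁅⁆⁻ : a ∈ R ∪ ⁅ x ⁆ → a ∈ R ⊎ a ≡ x
∪⁅⁆⁻ {R = R} {x = x} a∈ = Sum.map₂ (x∈⁅y⁆⇒x≡y x) (x∈p∪q⁻ R ⁅ x ⁆ a∈)

∪⁅⁆⁺ : a ∈ R ⊎ a ≡ x → a ∈ R ∪ ⁅ x ⁆
∪⁅⁆⁺ (inj₁ a∈R)  = x∈p∪q⁺ (inj₁ a∈R)
∪⁅⁆⁺ (inj₂ refl) = x∈p∪q⁺ (inj₂ (x∈⁅x⁆ _))

∈removeM⁻ : ∀ {o} → a ∈ removeM R o → a ∈ R × o ≢ just a
∈removeM⁻ {o = nothing} a∈ = a∈ , λ ()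
∈removeM⁻ {a = a} {R = R} {o = just z} a∈ with z F.≟ a
... | yes refl = contradiction (trans (sym (∈⇒lookup a∈)) (lookup∘update z R false)) λ ()
... | no z≢a   = lookup⇒∈ (trans (sym (lookup∘update′ (z≢a ∘ sym) R false)) (∈⇒lookup a∈)) ,
                 λ { refl → z≢a refl }

∈removeM⁺ : ∀ {o} → a ∈ R → o ≢ just a → a ∈ removeM R o
∈removeM⁺ {o = nothing} a∈R _ = a∈R
∈removeM⁺ {a = a} {R = R} {o = just z} a∈R z≢a with z F.≟ a
... | yes refl = contradiction refl z≢a
... | no z≢a′  = lookup⇒∈ (trans (lookup∘update′ (z≢a′ ∘ sym) R false) (∈⇒lookup a∈R))

sameY-just : ∀ {u v : Maybe (Fin n)} → sameY u v ≡ just z → u ≡ just z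
sameY-just {u = just a} {just b} eq with a F.≟ b
sameY-just {u = just a} {just b} refl | yes _ = refl
sameY-just {u = just a} {just b} ()   | no _

sameY-refl : ∀ (a : Fin n) → sameY (just a) (just a) ≡ just a
sameY-refl a with a F.≟ a
... | yes _  = refl
... | no a≢a = contradiction refl a≢a

lastIdx-holds : ∀ P k → 1 ≤ lastIdx P k → P (lastIdx P k) ≡ true
lastIdx-holds P (suc k) h with P (suc k) in eq
... | true  = eq
... | false = lastIdx-holds P k h

_≺_ : Subset n → Subset n → Set
R ≺ S = ∃ λ a → a ∈ R × ∀ b → b ∈ S → toℕ a < toℕ b

NStep-intro : S ⊆ R → R ≺ S → NStep R S
NStep-intro S⊆R (a , a∈R , a<S) = S⊆R , λ mR mS (_ , mR≤) (mS∈S , _) →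
  ≤-<-trans (mR≤ a a∈R) (a<S mS mS∈S)

IsNTableau-applyUpTo : ∀ L (f : ℕ → Subset n) →
  (∀ i → i < L → Nonempty (f i)) →
  (∀ i → suc i < L → NStep (f i) (f (suc i))) →
  IsNTableau (applyUpTo f L)
IsNTableau-applyUpTo zero          f ne step = tt
IsNTableau-applyUpTo (suc zero)    f ne step = ne 0 (s≤s z≤n)
IsNTableau-applyUpTo (suc (suc L)) f ne step =
  ne 0 (s≤s z≤n) , step 0 (s≤s (s≤s z≤n)) ,
  IsNTableau-applyUpTo (suc L) (f ∘ suc) (λ i → ne (suc i) ∘ s≤s) (λ i → step (suc i) ∘ s≤s)

row-∈⇒≤len : ∀ (T : Tableau n) i → a ∈ row T i → i ≤ len T
row-∈⇒≤len []      i             a∈ = contradiction a∈ ∉⊥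
row-∈⇒≤len (_ ∷ _) zero          a∈ = contradiction a∈ ∉⊥
row-∈⇒≤len (_ ∷ _) (suc zero)    a∈ = s≤s z≤n
row-∈⇒≤len (_ ∷ T) (suc (suc i)) a∈ = s≤s (row-∈⇒≤len T (suc i) a∈)

row-nonempty : ∀ (T : Tableau n) → IsNTableau T → ∀ i → suc i ≤ len T → Nonempty (row T (suc i))
row-nonempty (R ∷ [])    ne              zero    _         = ne
row-nonempty (R ∷ S ∷ T) (ne , _)        zero    _         = ne
row-nonempty (R ∷ [])    _               (suc i) (s≤s ())
row-nonempty (R ∷ S ∷ T) (_ , _ , H)     (suc i) (s≤s i<k) = row-nonempty (S ∷ T) H i i<k

row-step : ∀ (T : Tableau n) → IsNTableau T → ∀ i → suc (suc i) ≤ len T →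
  NStep (row T (suc i)) (row T (suc (suc i)))
row-step (R ∷ [])    _              i       (s≤s ())
row-step (R ∷ S ∷ T) (_ , step , _) zero    _         = step
row-step (R ∷ S ∷ T) (_ , _ , H)    (suc i) (s≤s i<k) = row-step (S ∷ T) H i i<k

row-suc-⊆ : ∀ (T : Tableau n) → IsNTableau T → ∀ i → row T (suc (suc i)) ⊆ row T (suc i)
row-suc-⊆ T H i a∈ = proj₁ (row-step T H i (row-∈⇒≤len T _ a∈)) a∈

row-antitone : ∀ (T : Tableau n) → IsNTableau T → ∀ {i j} → 1 ≤ i → i ≤ j → row T j ⊆ row T i
row-antitone T H (s≤s z≤n) (s≤s i≤j) = antitone i≤j
  where
  antitone : ∀ {i j} → i ≤ j → row T (suc j) ⊆ row T (suc i)
  antitone {j = zero} z≤n = λ a∈ → a∈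
  antitone {j = suc j} i≤sj with m≤n⇒m<n∨m≡n i≤sj
  ... | inj₁ (s≤s i≤j) = antitone i≤j ∘ row-suc-⊆ T H j
  ... | inj₂ refl      = λ a∈ → a∈

row-min<row-suc : ∀ (T : Tableau n) → IsNTableau T → ∀ i →
  IsMin m (row T (suc i)) → a ∈ row T (suc (suc i)) → toℕ m < toℕ a
row-min<row-suc T H i m-min a∈ =
  let m′ , m′-min = nonempty⇒min (_ , a∈)
  in <-≤-trans (proj₂ (row-step T H i (row-∈⇒≤len T _ a∈)) _ _ m-min m′-min) (proj₂ m′-min _ a∈)

row-≺ : ∀ (T : Tableau n) → IsNTableau T → ∀ i → suc (suc i) ≤ len T →
  row T (suc i) ≺ row T (suc (suc i))
row-≺ T H i i<k =
  let m , m-min = nonempty⇒min (row-nonempty T H i (≤-trans (n≤1+n _) i<k))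
  in m , proj₁ m-min , λ b → row-min<row-suc T H i m-min

le?-minRow⇒≤ : le? x (minRow R) ≡ true → ∀ a → a ∈ R → toℕ x ≤ toℕ a
le?-minRow⇒≤ {x = x} {R = R} eq a a∈R with minRow R in eqR
... | just m = ≤-trans (≤ᵇ≡true⇒≤ eq) (proj₂ (minRow-just eqR) a a∈R)

case1-NTableau : ∀ (x : Fin n) R T → IsNTableau (R ∷ T) →
  (∀ a → a ∈ R → toℕ x ≤ toℕ a) → IsNTableau (case1 x (R ∷ T))
case1-NTableau x R []      _ _ = x , ∪⁅⁆⁺ (inj₂ refl)
case1-NTableau x R (S ∷ T) H@(R≢∅ , (S⊆R , _) , H′) x≤R =
  (x , x∈R∪x) , NStep-intro (∪⁅⁆⁺ ∘ inj₁ ∘ S⊆R) (x , x∈R∪x , x<S) , H′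
  where
  x∈R∪x : x ∈ R ∪ ⁅ x ⁆
  x∈R∪x = ∪⁅⁆⁺ (inj₂ refl)
  x<S : ∀ b → b ∈ S → toℕ x < toℕ b
  x<S b b∈S with nonempty⇒min R≢∅
  ... | m , m-min = ≤-<-trans (x≤R m (proj₁ m-min)) (row-min<row-suc (R ∷ S ∷ T) H 0 m-min b∈S)

≤⊔-beyond : ∀ {i k t} → i ≤ k ⊔ t → t < i → i ≤ k
≤⊔-beyond {i} {k} {t} i≤k⊔t t<i with ≤-total k t
... | inj₁ k≤t = contradiction (subst (i ≤_) (m≤n⇒m⊔n≡n k≤t) i≤k⊔t) (<⇒≱ t<i)
... | inj₂ t≤k = subst (i ≤_) (m≥n⇒m⊔n≡m t≤k) i≤k⊔t

-- Case 3 of leftInsert, with its local definitions repeated verbatim so that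
-- leftInsert x T unfolds to case3.
module Case3 {n : ℕ} (x : Fin n) (T : Tableau n) where

  k : ℕ
  k = len T
  p : ℕ → Maybe (Fin n)
  p i = minRow (row T i)
  y : ℕ → Maybe (Fin n)
  y i = above x (row T i)
  t′ : ℕ
  t′ = lastIdx (λ i → ltM (p i) x) k
  t : ℕ
  t = suc t′
  r : ℕ
  r = lastIdx (λ i → lookup (row T i) x) k
  newRow : ℕ → Subset n
  newRow i =
    if (suc r ≤ᵇ i) ∧ (i ≤ᵇ t)
    then (if suc (suc r) ≤ᵇ i
          then removeM (row T i ∪ ⁅ x ⁆) (sameY (y i) (y (pred i)))
          else row T i ∪ ⁅ x ⁆)
    else row T i
  case3 : Tableau n
  case3 = applyUpTo (newRow ∘ suc) (k ⊔ t)

  removed : ℕ → Maybe (Fin n)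
  removed i = if suc (suc r) ≤ᵇ i then sameY (y i) (y (pred i)) else nothing

  removed-just : ∀ {i} → removed i ≡ just z → y i ≡ just z
  removed-just {i = i} eq with suc (suc r) ≤ᵇ i
  ... | true = sameY-just eq

  removed-intro : ∀ {i} → suc r < i → y i ≡ just z → y (pred i) ≡ just z → removed i ≡ just z
  removed-intro {z = z} r<i yi yi-1 =
    trans (if-true (≤⇒≤ᵇ≡true r<i)) (trans (cong₂ sameY yi yi-1) (sameY-refl z))

  removed-above-x : ∀ {i} → removed i ≡ just z → toℕ x < toℕ z
  removed-above-x {i = i} eq = proj₁ (proj₂ (above-just {R = row T i} (removed-just eq)))

  removed-≤x : ∀ {i} → toℕ a ≤ toℕ x → removed i ≢ just a
  removed-≤x a≤x eq = <⇒≱ (removed-above-x eq) a≤x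

  newRow-upto-r : ∀ {i} → i ≤ r → newRow i ≡ row T i
  newRow-upto-r {i} i≤r =
    if-false {b = (suc r ≤ᵇ i) ∧ (i ≤ᵇ t)} (cong (_∧ (i ≤ᵇ t)) (≰⇒≤ᵇ≡false (≤⇒≯ i≤r)))

  newRow-beyond-t : ∀ {i} → t < i → newRow i ≡ row T i
  newRow-beyond-t {i} t<i =
    if-false {b = (suc r ≤ᵇ i) ∧ (i ≤ᵇ t)} (trans (cong ((suc r ≤ᵇ i) ∧_) (≰⇒≤ᵇ≡false (<⇒≱ t<i))) (∧-zeroʳ _))

  newRow-between : ∀ {i} → r < i → i ≤ t → newRow i ≡ removeM (row T i ∪ ⁅ x ⁆) (removed i)
  newRow-between {i} r<i i≤t =
    trans (if-true {b = (suc r ≤ᵇ i) ∧ (i ≤ᵇ t)} (cong₂ _∧_ (≤⇒≤ᵇ≡true r<i) (≤⇒≤ᵇ≡true i≤t)))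
          (sym (if-float (removeM (row T i ∪ ⁅ x ⁆)) (suc (suc r) ≤ᵇ i)))

  ∈newRow-between⁻ : ∀ {i} → r < i → i ≤ t → a ∈ newRow i →
    (a ∈ row T i ⊎ a ≡ x) × removed i ≢ just a
  ∈newRow-between⁻ r<i i≤t a∈ =
    let a∈′ , kept = ∈removeM⁻ (subst (_ ∈_) (newRow-between r<i i≤t) a∈) in ∪⁅⁆⁻ a∈′ , kept

  ∈newRow-between⁺ : ∀ {i} → r < i → i ≤ t → a ∈ row T i ⊎ a ≡ x → removed i ≢ just a →
    a ∈ newRow i
  ∈newRow-between⁺ r<i i≤t a∈ kept =
    subst (_ ∈_) (sym (newRow-between r<i i≤t)) (∈removeM⁺ (∪⁅⁆⁺ a∈) kept)

  x∈newRow-between : ∀ {i} → r < i → i ≤ t → x ∈ newRow i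
  x∈newRow-between r<i i≤t = ∈newRow-between⁺ r<i i≤t (inj₂ refl) (removed-≤x ≤-refl)

  region : ∀ i → i ≤ r ⊎ (r < i × i ≤ t) ⊎ t < i
  region i with i ≤? r | i ≤? t
  ... | yes i≤r | _       = inj₁ i≤r
  ... | no i≰r  | yes i≤t = inj₂ (inj₁ (≰⇒> i≰r , i≤t))
  ... | no _    | no i≰t  = inj₂ (inj₂ (≰⇒> i≰t))

  ∈newRow⇒∈row∪x : ∀ i → a ∈ newRow i → a ∈ row T i ⊎ a ≡ x
  ∈newRow⇒∈row∪x i a∈ with region i
  ... | inj₁ i≤r               = inj₁ (subst (_ ∈_) (newRow-upto-r i≤r) a∈)
  ... | inj₂ (inj₁ (r<i , i≤t)) = proj₁ (∈newRow-between⁻ r<i i≤t a∈)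
  ... | inj₂ (inj₂ t<i)        = inj₁ (subst (_ ∈_) (newRow-beyond-t t<i) a∈)

  ∈row⇒∈newRow : ∀ i → a ∈ row T i → removed i ≢ just a → a ∈ newRow i
  ∈row⇒∈newRow i a∈ kept with region i
  ... | inj₁ i≤r               = subst (_ ∈_) (sym (newRow-upto-r i≤r)) a∈
  ... | inj₂ (inj₁ (r<i , i≤t)) = ∈newRow-between⁺ r<i i≤t (inj₁ a∈) kept
  ... | inj₂ (inj₂ t<i)        = subst (_ ∈_) (sym (newRow-beyond-t t<i)) a∈

  -- x<row-t is all that Case 3 uses of Cases 1 and 2 failing.
  module _ (H : IsNTableau T) (x<row-t : ∀ a → a ∈ row T t → toℕ x < toℕ a) where

    x∉row-from-t : ∀ {i} → t ≤ i → x ∉ row T i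
    x∉row-from-t t≤i x∈ = <-irrefl refl (x<row-t x (row-antitone T H (s≤s z≤n) t≤i x∈))

    x∈row-upto-r : ∀ {i} → 1 ≤ i → i ≤ r → x ∈ row T i
    x∈row-upto-r 1≤i i≤r = row-antitone T H 1≤i i≤r
      (lookup⇒∈ (lastIdx-holds (λ i → lookup (row T i) x) k (≤-trans 1≤i i≤r)))

    r<t : r < t
    r<t = ≰⇒> λ t≤r → x∉row-from-t t≤r (x∈row-upto-r (≤-trans (s≤s z≤n) t≤r) ≤-refl)

    row-min<x : ∀ {i} → 1 ≤ i → i ≤ t′ → ∃ λ m → IsMin m (row T i) × toℕ m < toℕ x
    row-min<x 1≤i i≤t′ with p t′ in p-t′ | lastIdx-holds (λ i → ltM (p i) x) k (≤-trans 1≤i i≤t′)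
    ... | just m′ | m′<x =
      let m′∈row = row-antitone T H 1≤i i≤t′ (proj₁ (minRow-just p-t′))
          m , m-min = nonempty⇒min (m′ , m′∈row)
      in m , m-min , ≤-<-trans (proj₂ m-min m′ m′∈row) (<ᵇ≡true⇒< m′<x)

    newRow-nonempty : ∀ i → suc i ≤ k ⊔ t → Nonempty (newRow (suc i))
    newRow-nonempty i i<L with region (suc i)
    ... | inj₁ i≤r =
      x , subst (x ∈_) (sym (newRow-upto-r i≤r)) (x∈row-upto-r (s≤s z≤n) i≤r)
    ... | inj₂ (inj₁ (r<i , i≤t)) = x , x∈newRow-between r<i i≤t
    ... | inj₂ (inj₂ t<i) =
      subst Nonempty (sym (newRow-beyond-t t<i)) (row-nonempty T H i (≤⊔-beyond i<L t<i))

    ⊆-upto-r : ∀ i → suc i ≤ r → newRow (suc (suc i)) ⊆ newRow (suc i)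
    ⊆-upto-r i i≤r a∈ with ∈newRow⇒∈row∪x (suc (suc i)) a∈
    ... | inj₁ a∈row = subst (_ ∈_) (sym (newRow-upto-r i≤r)) (row-suc-⊆ T H i a∈row)
    ... | inj₂ refl  = subst (_ ∈_) (sym (newRow-upto-r i≤r)) (x∈row-upto-r (s≤s z≤n) i≤r)

    ⊆-between : ∀ i → r < suc i → suc (suc i) ≤ t → newRow (suc (suc i)) ⊆ newRow (suc i)
    ⊆-between i r<i i<t a∈ with ∈newRow-between⁻ (m<n⇒m<1+n r<i) i<t a∈
    ... | inj₂ refl , _       = x∈newRow-between r<i (<⇒≤ i<t)
    ... | inj₁ a∈row , kept = ∈row⇒∈newRow (suc i) (row-suc-⊆ T H i a∈row) not-removed
      where
      not-removed = λ eq → kept (removed-intro (s≤s r<i)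
        (above-mono (row-suc-⊆ T H i) a∈row (removed-just eq)) (removed-just eq))

    ⊆-at-t : newRow (suc t) ⊆ newRow t
    ⊆-at-t {a} a∈ = ∈row⇒∈newRow t (row-suc-⊆ T H t′ a∈row) not-removed
      where
      a∈row : a ∈ row T (suc t)
      a∈row = subst (_ ∈_) (newRow-beyond-t (n<1+n t)) a∈
      not-removed : removed t ≢ just a
      not-removed eq = <-irrefl refl
        (row-min<row-suc T H t′ (above-all x<row-t (removed-just eq)) a∈row)

    ⊆-beyond-t : ∀ i → t < suc i → newRow (suc (suc i)) ⊆ newRow (suc i)
    ⊆-beyond-t i t<i =
      subst (_ ∈_) (sym (newRow-beyond-t t<i))
      ∘ row-suc-⊆ T H i
      ∘ subst (_ ∈_) (newRow-beyond-t (m<n⇒m<1+n t<i))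

    newRow-⊆ : ∀ i → newRow (suc (suc i)) ⊆ newRow (suc i)
    newRow-⊆ i with region (suc i)
    ... | inj₁ i≤r = ⊆-upto-r i i≤r
    ... | inj₂ (inj₂ t<i) = ⊆-beyond-t i t<i
    ... | inj₂ (inj₁ (r<i , i≤t)) with m≤n⇒m<n∨m≡n i≤t
    ...   | inj₁ i<t = ⊆-between i r<i i<t
    ...   | inj₂ i≡t = subst (λ j → newRow (suc j) ⊆ newRow j) (sym i≡t) ⊆-at-t

    ≺-below-t : ∀ i → suc i < t → newRow (suc i) ≺ newRow (suc (suc i))
    ≺-below-t i i<t with row-min<x (s≤s z≤n) (≤-pred i<t)
    ... | m , m-min , m<x = m , ∈row⇒∈newRow (suc i) (proj₁ m-min) (removed-≤x (<⇒≤ m<x)) , m<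
      where
      m< : ∀ b → b ∈ newRow (suc (suc i)) → toℕ m < toℕ b
      m< b b∈ with ∈newRow⇒∈row∪x (suc (suc i)) b∈
      ... | inj₁ b∈row = row-min<row-suc T H i m-min b∈row
      ... | inj₂ refl  = m<x

    ≺-at-t : newRow t ≺ newRow (suc t)
    ≺-at-t = x , x∈newRow-between r<t ≤-refl ,
      λ b → x<row-t b ∘ row-suc-⊆ T H t′ ∘ subst (_ ∈_) (newRow-beyond-t (n<1+n t))

    newRow-≺ : ∀ i → suc (suc i) ≤ k ⊔ t → newRow (suc i) ≺ newRow (suc (suc i))
    newRow-≺ i i<L with <-cmp (suc i) t
    ... | tri< i<t _ _ = ≺-below-t i i<t
    ... | tri≈ _ i≡t _ = subst (λ j → newRow j ≺ newRow (suc j)) (sym i≡t) ≺-at-t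
    ... | tri> _ _ t<i =
      subst₂ _≺_ (sym (newRow-beyond-t t<i)) (sym (newRow-beyond-t (m<n⇒m<1+n t<i)))
        (row-≺ T H i (≤⊔-beyond i<L (m<n⇒m<1+n t<i)))

    case3-NTableau : IsNTableau case3
    case3-NTableau = IsNTableau-applyUpTo (k ⊔ t) (newRow ∘ suc) newRow-nonempty
      λ i i<L → NStep-intro (newRow-⊆ i) (newRow-≺ i i<L)

case2-fails⇒x<row : ∀ (T : Tableau n) i → minRow (row T i) ≡ just m →
  ((i ≤ᵇ len T) ∧ (toℕ m ≤ᵇ toℕ x)) ≡ false → ∀ a → a ∈ row T i → toℕ x < toℕ a
case2-fails⇒x<row {m = m} {x = x} T i p-i fails a a∈ =
  <-≤-trans (≰⇒> m≰x) (proj₂ (minRow-just p-i) a a∈)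
  where
  m≰x : ¬ toℕ m ≤ toℕ x
  m≰x m≤x = contradiction
    (trans (sym (cong₂ _∧_ (≤⇒≤ᵇ≡true (row-∈⇒≤len T i a∈)) (≤⇒≤ᵇ≡true m≤x))) fails) λ ()

proposition11p2 : (n : ℕ) (T : Tableau n) (x : Fin n) →
    IsNTableau T → IsNTableau (leftInsert x T)
proposition11p2 n []        x _ = x , x∈⁅x⁆ x
proposition11p2 n T@(R ∷ _) x H with le? x (minRow R) in x≤p₁
... | true  = case1-NTableau x R _ H (le?-minRow⇒≤ x≤p₁)
... | false with minRow (row T (Case3.t x T)) in p-t
...   | nothing rewrite ∧-zeroʳ (Case3.t x T ≤ᵇ Case3.k x T) =
  Case3.case3-NTableau x T H λ a a∈ → contradiction a∈ (minRow-nothing p-t)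
...   | just m with (Case3.t x T ≤ᵇ Case3.k x T) ∧ (toℕ m ≤ᵇ toℕ x) in case2
...     | true  = H
...     | false = Case3.case3-NTableau x T H (case2-fails⇒x<row T (Case3.t x T) p-t case2)
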